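{- Let $p$ be a prime and $l\in\mathbb{N}$. If $u/v\in\mathcal{X}_{p^l}$ is a best $\mathcal{X}_{p^l}$-approximation of $r/(p^ls)\in\mathcal{X}_{p^l}$ (in lowest terms, $s>0$), then $v\le p^ls$.
   Context: $\mathcal{X}_{p^l}=\{x/y: x,y\in\mathbb{Z},\ y>0,\ \gcd(x,y)=1,\ p^l\mid y\}\cup\{\infty\}$. An element $u/v\in\mathcal{X}_{p^l}$ (lowest terms, $v>0$) is a best $\mathcal{X}_{p^l}$-approximation of $x\in\mathbb{R}$ if for every $u'/v'\in\mathcal{X}_{p^l}$ different from $u/v$ with $0<v'\le v$ one has $|vx-u|<|v'x-u'|$. -}

module Defs where

open import Data.Nat as ℕ using (ℕ; _≤_; _<_; _^_; >-nonZero)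
open import Data.Nat.Divisibility using (_∣_)
open import Data.Nat.Coprimality using (Coprime)
open import Data.Integer as ℤ using (ℤ; +_)
open import Data.Rational as ℚ using (ℚ)
open import Data.Product using (_×_)
open import Relation.Nullary using (¬_)
open import Relation.Binary.PropositionalEquality using (_≡_)

-- x / y (x : ℤ, y : ℕ) lies in 𝒳_q (finite part): y > 0, gcd(x,y) = 1, q ∣ y.
-- (∞ has denominator 0, so it never meets the condition 0 < v' below.)
InX : ℕ → ℤ → ℕ → Set
InX q x y = (0 < y) × Coprime (ℤ.∣ x ∣) y × (q ∣ y)

frac : ℤ → (n : ℕ) → 0 < n → ℚ
frac r n pos = ℚ._/_ r n {{>-nonZero pos}}

ι : ℤ → ℚ
ι z = z ℚ./ 1

BestApprox : ℕ → ℚ → ℤ → ℕ → Set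
BestApprox q x u v =
  InX q u v ×
  (∀ (u' : ℤ) (v' : ℕ) → InX q u' v' → ¬ (u' ≡ u × v' ≡ v) → v' ≤ v →
     ℚ.∣ ι (+ v) ℚ.* x ℚ.- ι u ∣ ℚ.< ℚ.∣ ι (+ v') ℚ.* x ℚ.- ι u' ∣)

module Submission where

open import Defs
open import Data.Nat using (ℕ; _≤_; _<_; _*_; _^_)
open import Data.Nat.Primality using (Prime)
open import Data.Nat.Coprimality using (Coprime)
open import Data.Integer using (ℤ; ∣_∣)

import Data.Nat as ℕ
import Data.Nat.Properties as ℕ
import Data.Integer as ℤ
open import Data.Integer.Solver using (module +-*-Solver)
import Data.Rational as ℚ
import Data.Rational.Properties as ℚ
import Data.Rational.Unnormalised as ℚᵘ
import Data.Rational.Unnormalised.Properties as ℚᵘ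
open import Data.Nat.Divisibility using (divides)
open import Data.Product using (_,_)
open import Relation.Binary.PropositionalEquality using (_≡_; refl; subst)
open import Data.Empty using (⊥-elim)
open import Relation.Nullary using (yes; no)

-- The point r/n itself lies in 𝒳_q with error 0, so a best approximation
-- with denominator v > n would have to beat it with an error below 0.

denominator-*-frac : (r : ℤ) (n : ℕ) (pos : 0 < n) → ι (ℤ.+ n) ℚ.* frac r n pos ≡ ι r
denominator-*-frac r n@(ℕ.suc k) pos = ℚ.toℚᵘ-injective (begin
  ℚ.toℚᵘ (ι (ℤ.+ n) ℚ.* frac r n pos)  ≈⟨ ℚ.toℚᵘ-homo-* (ι (ℤ.+ n)) (frac r n pos) ⟩
  ℚ.toℚᵘ (ι (ℤ.+ n)) ℚᵘ.* ℚ.toℚᵘ (frac r n pos)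
    ≈⟨ ℚᵘ.*-cong (ℚ.toℚᵘ-fromℚᵘ (ℚᵘ.mkℚᵘ (ℤ.+ n) 0)) (ℚ.toℚᵘ-fromℚᵘ (ℚᵘ.mkℚᵘ r k)) ⟩
  ℚᵘ.mkℚᵘ (ℤ.+ n) 0 ℚᵘ.* ℚᵘ.mkℚᵘ r k
    ≈⟨ ℚᵘ.*≡* (solve 2 (λ N R → (N :* R) :* con (ℤ.+ 1) := R :* (con (ℤ.+ 1) :* N)) refl (ℤ.+ n) r) ⟩
  ℚᵘ.mkℚᵘ r 0                          ≈⟨ ℚ.toℚᵘ-fromℚᵘ (ℚᵘ.mkℚᵘ r 0) ⟨
  ℚ.toℚᵘ (ι r)                         ∎)
  where
  open ℚᵘ.≃-Reasoning
  open +-*-Solver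

frac-error≡0 : (r : ℤ) (n : ℕ) (pos : 0 < n) → ι (ℤ.+ n) ℚ.* frac r n pos ℚ.- ι r ≡ ℚ.0ℚ
frac-error≡0 r n pos rewrite denominator-*-frac r n pos = ℚ.+-inverseʳ (ι r)

bestApprox-of-frac⇒denominator-≤ : (q : ℕ) (r : ℤ) (n : ℕ) (pos : 0 < n) → InX q r n
  → (u : ℤ) (v : ℕ) → BestApprox q (frac r n pos) u v → v ≤ n
bestApprox-of-frac⇒denominator-≤ q r n pos r/n∈X u v (_ , best) with v ℕ.≤? n
... | yes v≤n = v≤n
... | no v≰n = ⊥-elim (ℚ.<-irrefl refl (ℚ.≤-<-trans (ℚ.0≤∣p∣ error) beats-exact))
  where
  error : ℚ.ℚ
  error = ι (ℤ.+ v) ℚ.* frac r n pos ℚ.- ι u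
  n<v : n < v
  n<v = ℕ.≰⇒> v≰n
  beats-exact : ℚ.∣ error ∣ ℚ.< ℚ.0ℚ
  beats-exact = subst (λ e → ℚ.∣ error ∣ ℚ.< ℚ.∣ e ∣) (frac-error≡0 r n pos)
    (best r n r/n∈X (λ { (_ , n≡v) → ℕ.<⇒≢ n<v n≡v }) (ℕ.<⇒≤ n<v))

mainTheorem11 : (p l : ℕ) → Prime p → (r : ℤ) (s : ℕ) → (s>0 : 0 < s)
    → (pls>0 : 0 < p ^ l * s) → Coprime ∣ r ∣ (p ^ l * s)
    → (u : ℤ) (v : ℕ) → BestApprox (p ^ l) (frac r (p ^ l * s) pls>0) u v
    → v ≤ p ^ l * s
mainTheorem11 p l _ r s _ pls>0 coprime =
  bestApprox-of-frac⇒denominator-≤ (p ^ l) r (p ^ l * s) pls>0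
    (pls>0 , coprime , divides s (ℕ.*-comm (p ^ l) s))
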